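{- A reflexive graph $G$ has an invertible pair if and only if its auxiliary graph $G^+$ is not bipartite.
   Context: A reflexive graph is a finite undirected graph in which every vertex has a loop. $Z(G)$ is the set of ordered pairs of distinct vertices of $G$. For $(u,v),(u',v')\in Z(G)$, $(u,v)\,\Lambda\,(u',v')$ means $(u,v)=(u',v')$, or $uu',vv'\in E(G)$ and $uv',vu'\notin E(G)$; $\sim$ is the transitive closure of $\Lambda$. An invertible pair is a pair of distinct vertices $u,v$ with $(u,v)\sim(v,u)$. The auxiliary graph $G^+$ has vertex set $Z(G)$, and $(u,v)$ is adjacent to $(v',u')$ in $G^+$ if and only if $(u,v)\,\Lambda\,(u',v')$. -}

module Defs where

open import Data.Nat using (ℕ)
open import Data.Fin using (Fin)
open import Data.Bool using (Bool)
open import Data.Product using (Σ; _×_; _,_; proj₁; proj₂; ∃)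
open import Data.Sum using (_⊎_)
open import Relation.Nullary using (¬_; Dec)
open import Relation.Binary.PropositionalEquality using (_≡_; _≢_)
open import Relation.Binary.Construct.Closure.ReflexiveTransitive using (Star)
open import Level using (0ℓ)

record ReflexiveGraph (n : ℕ) : Set₁ where
  field
    E     : Fin n → Fin n → Set
    E?    : ∀ u v → Dec (E u v)
    sym   : ∀ {u v} → E u v → E v u
    refl  : ∀ u → E u u

module _ {n : ℕ} (G : ReflexiveGraph n) where
  open ReflexiveGraph G

  Z : Set
  Z = Σ (Fin n × Fin n) (λ p → proj₁ p ≢ proj₂ p)

  fst snd : Z → Fin n
  fst z = proj₁ (proj₁ z)
  snd z = proj₂ (proj₁ z)

  Λ : Z → Z → Set
  Λ z z' = (proj₁ z ≡ proj₁ z')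
         ⊎ ((E (fst z) (fst z') × E (snd z) (snd z'))
            × (¬ E (fst z) (snd z') × ¬ E (snd z) (fst z')))

  -- ∼ : transitive closure of Λ (Λ is reflexive, so Star Λ is it)
  _∼_ : Z → Z → Set
  _∼_ = Star Λ

  swap : Z → Z
  swap ((u , v) , u≢v) = (v , u) , λ e → u≢v (Relation.Binary.PropositionalEquality.sym e)

  HasInvertiblePair : Set
  HasInvertiblePair = Σ Z (λ z → z ∼ swap z)

  Adj⁺ : Z → Z → Set
  Adj⁺ z w = Λ z (swap w)

  Bipartite⁺ : Set
  Bipartite⁺ = Σ (Z → Bool) (λ c → ∀ z w → Adj⁺ z w → ¬ (c z ≡ c w))

{-# OPTIONS --safe #-}
-- A proper colouring c must separate z from swap z (they are adjacent through
-- the loop Λ z z) and is constant along Λ (z Λ w makes z adjacent to swap w,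
-- which is adjacent to w), so an invertible pair z ∼ swap z is impossible.
-- Conversely, if no pair is invertible, the ∼-classes of z and swap z always
-- differ; since Λ commutes with swap, choosing one class out of every such
-- couple and colouring it true gives a proper colouring. The choice is made
-- constructively by comparing the characteristic vectors of the two classes
-- lexicographically, which needs ∼ to be decidable: reachability in a finite
-- graph.
module Submission where

open import Defs
open import Level using (Level)
open import Data.Nat using (ℕ; zero; suc; _*_)
open import Data.Fin using (Fin; zero; suc; punchIn; punchOut; combine; remQuot; _≟_)
open import Data.Fin.Properties using (punchIn-punchOut; punchInᵢ≢i; any?; remQuot-combine)
open import Data.Empty using (⊥-elim)
open import Data.Bool using (Bool; true; false; not)
open import Data.Bool.Properties using (not-¬; ¬-not)
open import Data.Product using (_×_; _,_; proj₁; proj₂; ∃; uncurry) renaming (swap to swapᴾ)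
open import Data.Product.Properties using (≡-dec)
open import Data.Sum using (_⊎_; inj₁; inj₂)
open import Function using (_∘_; id; mk⇔)
open import Relation.Binary using (Rel; Decidable)
open import Relation.Nullary using (¬_; Dec; yes; no; does)
open import Relation.Nullary.Decidable
  using (_×-dec_; _⊎-dec_; ¬?; map′; dec-true; dec-false; does-⇔; decidable-stable)
open import Relation.Binary.PropositionalEquality
  using (_≡_; _≢_; _≗_; refl; sym; trans; cong; subst; subst₂; module ≡-Reasoning)
open import Relation.Binary.Construct.Closure.ReflexiveTransitive
  using (Star; ε; _◅_; _◅◅_; gmap; reverse)

private
  variable
    ℓ : Level

Star-decidable : ∀ {m} {R : Rel (Fin m) ℓ} → Decidable R → Decidable (Star R)
Star-decidable {m = zero} R? ()
Star-decidable {m = suc m} {R = R} R? x y with x ≟ y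
... | yes refl = yes ε
... | no x≢y = map′ (uncurry viaNeighbour) route (any? route?)
  where
  -- R on the complement of x, reindexed by Fin m
  R∖x : Rel (Fin m) _
  R∖x a b = R (punchIn x a) (punchIn x b)

  y∖x : Fin m
  y∖x = punchOut x≢y

  Route : Fin m → Set _
  Route w = R x (punchIn x w) × Star R∖x w y∖x

  route? : ∀ w → Dec (Route w)
  route? w = R? x (punchIn x w) ×-dec Star-decidable (λ a b → R? (punchIn x a) (punchIn x b)) w y∖x

  viaNeighbour : ∀ w → Route w → Star R x y
  viaNeighbour w (r , p) =
    r ◅ subst (Star R (punchIn x w)) (punchIn-punchOut x≢y) (gmap (punchIn x) id p)

  -- A path s ⇝ y either avoids x, or its part after the last visit to x is a route.
  avoidsOrRoutes : ∀ {s} → Star R s y → (∃ λ a → punchIn x a ≡ s × Star R∖x a y∖x) ⊎ ∃ Route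
  avoidsOrRoutes ε = inj₁ (y∖x , punchIn-punchOut x≢y , ε)
  avoidsOrRoutes {s} (r ◅ rest) with avoidsOrRoutes rest
  ... | inj₂ q = inj₂ q
  ... | inj₁ (a , refl , p) with s ≟ x
  ...   | yes refl = inj₂ (a , r , p)
  ...   | no s≢x =
          inj₁ (punchOut (s≢x ∘ sym) , punchIn-punchOut _ ,
                subst (λ t → R t (punchIn x a)) (sym (punchIn-punchOut _)) r ◅ p)

  route : Star R x y → ∃ Route
  route p with avoidsOrRoutes p
  ... | inj₁ (a , a↦x , _) = ⊥-elim (punchInᵢ≢i x a a↦x)
  ... | inj₂ q = q

Star-decidable-retract : ∀ {m a} {A : Set a} {R : Rel A ℓ}
  (encode : A → Fin m) (decode : Fin m → A) → (∀ x → decode (encode x) ≡ x) →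
  Decidable R → Decidable (Star R)
Star-decidable-retract {R = R} encode decode decode∘encode R? x y =
  map′ (subst₂ (Star R) (decode∘encode x) (decode∘encode y) ∘ gmap decode id)
       (gmap encode (λ {x} {y} r → subst₂ R (sym (decode∘encode x)) (sym (decode∘encode y)) r))
       (Star-decidable (λ i j → R? (decode i) (decode j)) (encode x) (encode y))

lexStep : Bool → Bool → Bool → Bool
lexStep false true  _ = true
lexStep true  false _ = false
lexStep _     _     r = r

lexLess : ∀ {m} → (Fin m → Bool) → (Fin m → Bool) → Bool
lexLess {zero}  f g = false
lexLess {suc m} f g = lexStep (f zero) (g zero) (lexLess (f ∘ suc) (g ∘ suc))

lexLess-cong : ∀ {m} {f f′ g g′ : Fin m → Bool} → f ≗ f′ → g ≗ g′ → lexLess f g ≡ lexLess f′ g′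
lexLess-cong {zero}  f≗f′ g≗g′ = refl
lexLess-cong {suc m} f≗f′ g≗g′ rewrite f≗f′ zero | g≗g′ zero =
  cong (lexStep _ _) (lexLess-cong (f≗f′ ∘ suc) (g≗g′ ∘ suc))

lexStep-≢ : ∀ {a b} r r′ → a ≢ b → lexStep a b r ≡ not (lexStep b a r′)
lexStep-≢ {true}  {true}  r r′ a≢b = ⊥-elim (a≢b refl)
lexStep-≢ {true}  {false} r r′ a≢b = refl
lexStep-≢ {false} {true}  r r′ a≢b = refl
lexStep-≢ {false} {false} r r′ a≢b = ⊥-elim (a≢b refl)

lexStep-not : ∀ a b {r r′} → r ≡ not r′ → lexStep a b r ≡ not (lexStep b a r′)
lexStep-not true  true  r≡¬r′ = r≡¬r′
lexStep-not true  false r≡¬r′ = refl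
lexStep-not false true  r≡¬r′ = refl
lexStep-not false false r≡¬r′ = r≡¬r′

lexLess-antisym : ∀ {m} {f g : Fin m → Bool} i → f i ≢ g i → lexLess f g ≡ not (lexLess g f)
lexLess-antisym zero    f≢g = lexStep-≢ _ _ f≢g
lexLess-antisym (suc i) f≢g = lexStep-not _ _ (lexLess-antisym i f≢g)

module _ {n : ℕ} (G : ReflexiveGraph n) where
  open ReflexiveGraph G using (E; E?) renaming (sym to E-sym)

  Pair : Set
  Pair = Fin n × Fin n

  -- Λ on all ordered pairs; Λ G (p , _) (q , _) unfolds to Λᴾ p q.
  Λᴾ : Rel Pair _
  Λᴾ (u , v) (u′ , v′) = (u , v) ≡ (u′ , v′) ⊎ ((E u u′ × E v v′) × (¬ E u v′ × ¬ E v u′))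

  _∼ᴾ_ : Rel Pair _
  _∼ᴾ_ = Star Λᴾ

  Λᴾ? : Decidable Λᴾ
  Λᴾ? (u , v) (u′ , v′) = ≡-dec _≟_ _≟_ (u , v) (u′ , v′)
    ⊎-dec ((E? u u′ ×-dec E? v v′) ×-dec (¬? (E? u v′) ×-dec ¬? (E? v u′)))

  encodePair : Pair → Fin (n * n)
  encodePair = uncurry combine

  decodePair : Fin (n * n) → Pair
  decodePair = remQuot n

  decode-encodePair : ∀ p → decodePair (encodePair p) ≡ p
  decode-encodePair = uncurry remQuot-combine

  _∼ᴾ?_ : Decidable _∼ᴾ_
  _∼ᴾ?_ = Star-decidable-retract encodePair decodePair decode-encodePair Λᴾ?

  Λᴾ-sym : ∀ {p q} → Λᴾ p q → Λᴾ q p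
  Λᴾ-sym (inj₁ p≡q) = inj₁ (sym p≡q)
  Λᴾ-sym (inj₂ ((uu′ , vv′) , (¬uv′ , ¬vu′))) =
    inj₂ ((E-sym uu′ , E-sym vv′) , (¬vu′ ∘ E-sym , ¬uv′ ∘ E-sym))

  Λᴾ-swap : ∀ {p q} → Λᴾ p q → Λᴾ (swapᴾ p) (swapᴾ q)
  Λᴾ-swap (inj₁ p≡q) = inj₁ (cong swapᴾ p≡q)
  Λᴾ-swap (inj₂ ((uu′ , vv′) , (¬uv′ , ¬vu′))) = inj₂ ((vv′ , uu′) , (¬vu′ , ¬uv′))

  ∼ᴾ-sym : ∀ {p q} → p ∼ᴾ q → q ∼ᴾ p
  ∼ᴾ-sym = reverse Λᴾ-sym

  -- A non-trivial step can never reach the diagonal: E u u′ and ¬ E u v′ force u′ ≢ v′.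
  Λᴾ-distinct : ∀ {p q} → Λᴾ p q → proj₁ p ≢ proj₂ p → proj₁ q ≢ proj₂ q
  Λᴾ-distinct (inj₁ refl) u≢v = u≢v
  Λᴾ-distinct (inj₂ ((uu′ , _) , (¬uv′ , _))) _ u′≡v′ = ¬uv′ (subst (E _) u′≡v′ uu′)

  ∼⇒∼ᴾ : ∀ {z w} → _∼_ G z w → proj₁ z ∼ᴾ proj₁ w
  ∼⇒∼ᴾ = gmap proj₁ id

  ∼ᴾ⇒∼ : ∀ {p q} → p ∼ᴾ q → (u≢v : proj₁ p ≢ proj₂ p) (u′≢v′ : proj₁ q ≢ proj₂ q) →
         _∼_ G (p , u≢v) (q , u′≢v′)
  ∼ᴾ⇒∼ ε         u≢v u′≢v′ = inj₁ refl ◅ ε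
  ∼ᴾ⇒∼ (l ◅ p∼q) u≢v u′≢v′ = l ◅ ∼ᴾ⇒∼ p∼q (Λᴾ-distinct l u≢v) u′≢v′

  hasInvertiblePair? : Dec (HasInvertiblePair G)
  hasInvertiblePair? =
    map′ (λ (u , v , u≢v , uv∼vu) → ((u , v) , u≢v) , ∼ᴾ⇒∼ uv∼vu u≢v _)
         (λ ((uv , u≢v) , z∼swapz) → proj₁ uv , proj₂ uv , u≢v , ∼⇒∼ᴾ z∼swapz)
         (any? λ u → any? λ v → ¬? (u ≟ v) ×-dec ((u , v) ∼ᴾ? (v , u)))

  bipartite⇒¬invertible : Bipartite⁺ G → ¬ HasInvertiblePair G
  bipartite⇒¬invertible (c , proper) (z , z∼swapz) = separates z (constant z∼swapz)
    where
    separates : ∀ z → c z ≢ c (swap G z)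
    separates z = proper z (swap G z) (inj₁ refl)

    constant : ∀ {z w} → _∼_ G z w → c z ≡ c w
    constant ε = refl
    constant {z} (_◅_ {j = w} l w∼) =
      trans (trans (¬-not (proper z (swap G w) l)) (sym (¬-not (separates w)))) (constant w∼)

  classVector : Pair → Fin (n * n) → Bool
  classVector p i = does (p ∼ᴾ? decodePair i)

  classVector-cong : ∀ {p q} → p ∼ᴾ q → classVector p ≗ classVector q
  classVector-cong p∼q i =
    does-⇔ (mk⇔ (∼ᴾ-sym p∼q ◅◅_) (p∼q ◅◅_)) (_ ∼ᴾ? decodePair i) (_ ∼ᴾ? decodePair i)

  classVector-self : ∀ p → classVector p (encodePair p) ≡ true
  classVector-self p = dec-true (p ∼ᴾ? _) (subst (p ∼ᴾ_) (sym (decode-encodePair p)) ε)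

  orientation : Z G → Bool
  orientation ((u , v) , _) = lexLess (classVector (u , v)) (classVector (v , u))

  ¬invertible⇒bipartite : ¬ HasInvertiblePair G → Bipartite⁺ G
  ¬invertible⇒bipartite noInvertible = orientation , λ z w l e → not-¬ e (flips z w l)
    where
    classVector-swap : ∀ w → classVector (swapᴾ (proj₁ w)) (encodePair (proj₁ w)) ≡ false
    classVector-swap (q , u≢v) = dec-false (swapᴾ q ∼ᴾ? _) λ swapq∼q →
      noInvertible ((q , u≢v) ,
        ∼ᴾ⇒∼ (∼ᴾ-sym (subst (swapᴾ q ∼ᴾ_) (decode-encodePair q) swapq∼q)) u≢v _)

    flips : ∀ z w → Adj⁺ G z w → orientation z ≡ not (orientation w)
    flips (p , _) w@(q , _) l = begin
      lexLess (classVector p) (classVector (swapᴾ p))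
        ≡⟨ lexLess-cong (classVector-cong (l ◅ ε)) (classVector-cong (Λᴾ-swap l ◅ ε)) ⟩
      lexLess (classVector (swapᴾ q)) (classVector q)
        ≡⟨ lexLess-antisym (encodePair q)
             (subst₂ _≢_ (sym (classVector-swap w)) (sym (classVector-self q)) λ ()) ⟩
      not (lexLess (classVector q) (classVector (swapᴾ q))) ∎
      where open ≡-Reasoning

proposition10 : (n : ℕ) (G : ReflexiveGraph n) →
    (HasInvertiblePair G → ¬ Bipartite⁺ G) × (¬ Bipartite⁺ G → HasInvertiblePair G)
proposition10 n G =
    (λ invertible bipartite → bipartite⇒¬invertible G bipartite invertible)
  , (λ ¬bipartite → decidable-stable (hasInvertiblePair? G) (¬bipartite ∘ ¬invertible⇒bipartite G))
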